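{- Every Hamiltonian cubic graph is an AR-graph.
   Context: All graphs are finite, simple and undirected; $\mathbb{N}=\{1,2,3,\dots\}$. Let $f:E(G)\to\mathbb{N}$ be an injective edge labeling of a graph $G$. A vertex $v$ is an AR-vertex (under $f$) if, whenever $x_1,\dots,x_k$ are the labels of the $k$ edges incident on $v$, the $2^k$ sums $\sum_{i\in S}x_i$ over all subsets $S\subseteq\{1,\dots,k\}$ are pairwise distinct. An injective labeling $f:E(G)\to\mathbb{N}$ is an AR-labeling if every vertex of $G$ is an AR-vertex under $f$. A graph $G$ with $m$ edges is an AR-graph if it has an AR-labeling $f:E(G)\to\{1,2,\dots,m\}$. A cubic graph is a 3-regular graph; it is Hamiltonian if it has a cycle through all its vertices. -}

module Defs where

open import Data.Nat using (ℕ; zero; suc; _+_; _≤_; _∸_)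
open import Data.Fin using (Fin; toℕ)
open import Data.Fin.Subset using (Subset; _⊆_; ∣_∣)
open import Data.Bool using (Bool; true; false)
open import Data.Vec using (Vec; []; _∷_; tabulate)
open import Data.Product using (_×_; _,_; proj₁; proj₂; ∃; Σ)
open import Data.Sum using (_⊎_)
open import Relation.Binary.PropositionalEquality using (_≡_; _≢_)
open import Relation.Nullary using (does)
open import Relation.Nullary.Decidable using (_⊎-dec_)
open import Function.Definitions using (Injective; Bijective)
import Data.Fin.Properties as FinP

record Graph : Set where
  field
    n        : ℕ
    m        : ℕ
    ends     : Fin m → Fin n × Fin n
    loopless : ∀ e → proj₁ (ends e) ≢ proj₂ (ends e)
    simple   : ∀ e e' →
               ((proj₁ (ends e) ≡ proj₁ (ends e')) × (proj₂ (ends e) ≡ proj₂ (ends e')))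
               ⊎ ((proj₁ (ends e) ≡ proj₂ (ends e')) × (proj₂ (ends e) ≡ proj₁ (ends e')))
               → e ≡ e'

module _ (G : Graph) where
  open Graph G

  Incident : Fin n → Fin m → Set
  Incident v e = proj₁ (ends e) ≡ v ⊎ proj₂ (ends e) ≡ v

  incidentEdges : Fin n → Subset m
  incidentEdges v = tabulate (λ e → does ((proj₁ (ends e) FinP.≟ v) ⊎-dec (proj₂ (ends e) FinP.≟ v)))

  degree : Fin n → ℕ
  degree v = ∣ incidentEdges v ∣

  Cubic : Set
  Cubic = ∀ v → degree v ≡ 3

  Adjacent : Fin n → Fin n → Set
  Adjacent u v = ∃ λ e → ends e ≡ (u , v) ⊎ ends e ≡ (v , u)

  Hamiltonian : Set
  Hamiltonian = 3 ≤ n × Σ (Fin n → Fin n) λ σ →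
      Bijective _≡_ _≡_ σ
    × (∀ (i j : Fin n) → toℕ j ≡ suc (toℕ i) → Adjacent (σ i) (σ j))
    × (∀ (i j : Fin n) → toℕ i ≡ n ∸ 1 → toℕ j ≡ 0 → Adjacent (σ i) (σ j))

subsetSum : ∀ {k} → (Fin k → ℕ) → Subset k → ℕ
subsetSum {zero}  x []          = 0
subsetSum {suc k} x (true ∷ S)  = x Fin.zero + subsetSum (λ i → x (Fin.suc i)) S
subsetSum {suc k} x (false ∷ S) = subsetSum (λ i → x (Fin.suc i)) S

module _ (G : Graph) where
  open Graph G

  ARVertex : (Fin m → ℕ) → Fin n → Set
  ARVertex f v = ∀ (S T : Subset m) → S ⊆ incidentEdges G v → T ⊆ incidentEdges G v →
                 subsetSum f S ≡ subsetSum f T → S ≡ T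

  ARLabeling : (Fin m → ℕ) → Set
  ARLabeling f = Injective _≡_ _≡_ f × (∀ v → ARVertex f v)

  ARGraph : Set
  ARGraph = Σ (Fin m → ℕ) λ f → (∀ e → 1 ≤ f e × f e ≤ m) × ARLabeling f

-- A Hamiltonian cubic graph has n = 2K vertices and m = 3K edges: the n edges of the Hamiltonian
-- cycle and K chords forming a perfect matching. Label the cycle edge at position 2j by K + j and the
-- one at position 2j+1 by 2K+1+j, and give the chords the remaining labels 1, …, K − 1, 2K, with 1 on
-- the chord at the vertex in position 0. Three distinct positive numbers have distinct subset sums
-- unless one is the sum of the other two. At every vertex the two cycle labels x, y are at least K
-- and differ by d = K + 1, K, or (at position 0) 2K, while the chord label z is at most 2K and is
-- never d; hence z < x + y, and neither x = y + z nor y = x + z can hold.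
module Submission where

open import Defs

open import Algebra.Properties.CommutativeSemigroup using (x∙yz≈y∙xz)
open import Data.Bool using (Bool; true; false; if_then_else_)
open import Data.Empty using (⊥-elim)
open import Data.Unit using (⊤)
open import Data.Fin using (Fin; zero; suc; toℕ; fromℕ; fromℕ<; inject₁; lower₁)
import Data.Fin.Properties as Finₚ
open import Data.Fin.Properties
  using (_≟_; toℕ-injective; toℕ<n; toℕ-fromℕ; toℕ-fromℕ<; toℕ-inject₁; toℕ-lower₁; any?)
open import Data.Nat using (ℕ; zero; suc; _+_; _∸_; ⌊_/2⌋; _≤_; _<_; z≤n; s≤s; z<s; _<?_)
open import Data.Nat.Properties hiding (_≟_)
import Data.Nat.Properties as ℕₚ
open import Data.Product using (_×_; _,_; proj₁; proj₂; ∃; swap)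
open import Data.Product.Properties using (,-injective)
open import Data.Sum using (_⊎_; inj₁; inj₂)
import Data.Sum as Sum
open import Data.Fin.Subset using (Subset; _⊆_; ∣_∣)
open import Data.Vec using ([]; _∷_; lookup; tabulate)
open import Data.Vec.Properties
  using (lookup∘tabulate; tabulate∘lookup; tabulate-cong; []=⇒lookup; lookup⇒[]=)
open import Data.Vec.Functional using (updateAt)
open import Data.Vec.Functional.Properties using (updateAt-updates; updateAt-minimal)
open import Function using (_∘_; _$_; id; const; _⇔_; mk⇔; case_of_)
open import Level using (Level; _⊔_)
open import Relation.Binary.Definitions using (tri<; tri≈; tri>)
open import Relation.Binary.PropositionalEquality
open import Relation.Nullary using (¬_; Dec; yes; no; does; _×-dec_; _⊎-dec_; ¬?; contradiction)
open import Relation.Nullary.Decidable using (dec-true; dec-false; dec-yes; dec-no; does-⇔)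
open import Relation.Unary using (Pred; Decidable)

open import Algebra.Properties.Monoid.Sum +-0-monoid using (sum; sum-cong-≗; sum-replicate-zero)

private
  variable
    ℓ ℓ′ : Level
    k l : ℕ

-- Finite sums and counting

sum-remove : (g : Fin k → ℕ) (i : Fin k) → sum g ≡ g i + sum (updateAt g i (const 0))
sum-remove g zero    = refl
sum-remove g (suc i) = trans (cong (g zero +_) (sum-remove (g ∘ suc) i))
                             (x∙yz≈y∙xz +-commutativeSemigroup (g zero) (g (suc i)) _)

sum-vanishing : {g : Fin k → ℕ} → (∀ i → g i ≡ 0) → sum g ≡ 0
sum-vanishing {k} g≗0 = trans (sum-cong-≗ g≗0) (sum-replicate-zero k)

sum-supported-on-three : (g : Fin k → ℕ) {a b c : Fin k} → a ≢ b → a ≢ c → b ≢ c →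
                         (∀ i → i ≢ a → i ≢ b → i ≢ c → g i ≡ 0) →
                         sum g ≡ g a + (g b + g c)
sum-supported-on-three g {a} {b} {c} a≢b a≢c b≢c outside = begin
  sum g                          ≡⟨ sum-remove g a ⟩
  g a + sum g₁                   ≡⟨ cong (g a +_) (sum-remove g₁ b) ⟩
  g a + (g₁ b + sum g₂)          ≡⟨ cong (λ t → g a + (g₁ b + t)) (sum-remove g₂ c) ⟩
  g a + (g₁ b + (g₂ c + sum g₃)) ≡⟨ cong₂ (λ s t → g a + (s + t)) g₁b≡gb
                                             (cong₂ _+_ g₂c≡gc (sum-vanishing g₃≗0)) ⟩
  g a + (g b + (g c + 0))        ≡⟨ cong (λ t → g a + (g b + t)) (+-identityʳ (g c)) ⟩
  g a + (g b + g c)              ∎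
  where
  open ≡-Reasoning
  g₁ g₂ g₃ : Fin _ → ℕ
  g₁ = updateAt g a (const 0)
  g₂ = updateAt g₁ b (const 0)
  g₃ = updateAt g₂ c (const 0)
  g₁b≡gb : g₁ b ≡ g b
  g₁b≡gb = updateAt-minimal b a g (≢-sym a≢b)
  g₂c≡gc : g₂ c ≡ g c
  g₂c≡gc = trans (updateAt-minimal c b g₁ (≢-sym b≢c)) (updateAt-minimal c a g (≢-sym a≢c))
  g₃≗0 : ∀ i → g₃ i ≡ 0
  g₃≗0 i with i ≟ c | i ≟ b | i ≟ a
  ... | yes refl | _        | _        = updateAt-updates c g₂
  ... | no i≢c   | yes refl | _        = trans (updateAt-minimal i c g₂ i≢c) (updateAt-updates b g₁)
  ... | no i≢c   | no i≢b   | yes refl =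
    trans (updateAt-minimal i c g₂ i≢c) (trans (updateAt-minimal i b g₁ i≢b) (updateAt-updates a g))
  ... | no i≢c   | no i≢b   | no i≢a   =
    trans (updateAt-minimal i c g₂ i≢c) (trans (updateAt-minimal i b g₁ i≢b)
      (trans (updateAt-minimal i a g i≢a) (outside i i≢a i≢b i≢c)))

infixl 7 _·_
_·_ : Bool → ℕ → ℕ
b · x = if b then x else 0

·-≤ : ∀ b {x} → b · x ≤ x
·-≤ true  = ≤-refl
·-≤ false = z≤n

subsetSum≡sum : (f : Fin k → ℕ) (S : Subset k) → subsetSum f S ≡ sum (λ i → lookup S i · f i)
subsetSum≡sum {k = zero}  f []          = refl
subsetSum≡sum {k = suc k} f (true ∷ S)  = cong (f zero +_) (subsetSum≡sum (f ∘ suc) S)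
subsetSum≡sum {k = suc k} f (false ∷ S) = subsetSum≡sum (f ∘ suc) S

does⇒ : {A : Set ℓ} (a? : Dec A) → does a? ≡ true → A
does⇒ (yes a) _ = a

indicator : {A : Set ℓ} → Dec A → ℕ
indicator a? = does a? · 1

indicator-yes : {A : Set ℓ} (a? : Dec A) → A → indicator a? ≡ 1
indicator-yes a? a = cong (_· 1) (dec-true a? a)

indicator-no : {A : Set ℓ} (a? : Dec A) → ¬ A → indicator a? ≡ 0
indicator-no a? ¬a = cong (_· 1) (dec-false a? ¬a)

indicator-⇔ : {A : Set ℓ} {B : Set ℓ′} → A ⇔ B → (a? : Dec A) (b? : Dec B) →
              indicator a? ≡ indicator b?
indicator-⇔ A⇔B a? b? = cong (_· 1) (does-⇔ A⇔B a? b?)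

count : {P : Pred (Fin k) ℓ} → Decidable P → ℕ
count P? = sum (indicator ∘ P?)

remove? : {P : Pred (Fin k) ℓ} → Decidable P → (i : Fin k) → Decidable (λ j → P j × j ≢ i)
remove? P? i j = P? j ×-dec ¬? (j ≟ i)

count-cong : {P : Pred (Fin k) ℓ} {Q : Pred (Fin k) ℓ′} (P? : Decidable P) (Q? : Decidable Q) →
             (∀ i → P i ⇔ Q i) →
             count P? ≡ count Q?
count-cong P? Q? P⇔Q = sum-cong-≗ λ i → indicator-⇔ (P⇔Q i) (P? i) (Q? i)

count-remove : {P : Pred (Fin k) ℓ} (P? : Decidable P) {i : Fin k} → P i →
               count P? ≡ suc (count (remove? P? i))
count-remove P? {i} Pi = begin
  count P?                                                         ≡⟨ sum-remove (indicator ∘ P?) i ⟩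
  indicator (P? i) + sum (updateAt (indicator ∘ P?) i (const 0))  ≡⟨ cong₂ _+_ (indicator-yes (P? i) Pi)
                                                                                (sum-cong-≗ removed) ⟩
  suc (count (remove? P? i))                                       ∎
  where
  open ≡-Reasoning
  removed : ∀ j → updateAt (indicator ∘ P?) i (const 0) j ≡ indicator (remove? P? i j)
  removed j = by-cases (j ≟ i)
    where
    by-cases : Dec (j ≡ i) → updateAt (indicator ∘ P?) i (const 0) j ≡ indicator (remove? P? i j)
    by-cases (yes refl) = trans (updateAt-updates i (indicator ∘ P?))
                                (sym (indicator-no (remove? P? i i) (λ (_ , i≢i) → i≢i refl)))
    by-cases (no j≢i)   = trans (updateAt-minimal j i (indicator ∘ P?) j≢i)
                                (indicator-⇔ (mk⇔ (_, j≢i) proj₁) (P? j) (remove? P? i j))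

count-pos : {P : Pred (Fin k) ℓ} (P? : Decidable P) {i : Fin k} → P i → 0 < count P?
count-pos P? Pi = subst (0 <_) (sym (count-remove P? Pi)) z<s

count-none : {P : Pred (Fin k) ℓ} (P? : Decidable P) → (∀ i → ¬ P i) → count P? ≡ 0
count-none P? ¬P = sum-vanishing λ i → indicator-no (P? i) (¬P i)

count-all : {P : Pred (Fin k) ℓ} (P? : Decidable P) → (∀ i → P i) → count P? ≡ k
count-all {k = zero}  P? all = refl
count-all {k = suc k} P? all =
  cong₂ _+_ (indicator-yes (P? zero) (all zero)) (count-all (P? ∘ suc) (all ∘ suc))

count-complement : {P : Pred (Fin k) ℓ} (P? : Decidable P) → count P? + count (¬? ∘ P?) ≡ k
count-complement {k = zero}  P? = refl
count-complement {k = suc k} P? with P? zero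
... | yes _ = cong suc (count-complement (P? ∘ suc))
... | no _  = trans (+-suc _ _) (cong suc (count-complement (P? ∘ suc)))

count-witness : {P : Pred (Fin k) ℓ} (P? : Decidable P) → 0 < count P? → ∃ P
count-witness P? 0<count with any? P?
... | yes witness = witness
... | no ∄P       = contradiction (count-none P? (λ i Pi → ∄P (i , Pi))) (>⇒≢ 0<count)

count≡1-unique : {P : Pred (Fin k) ℓ} (P? : Decidable P) → count P? ≡ 1 →
                 ∀ {i j} → P i → P j → i ≡ j
count≡1-unique P? count≡1 {i} {j} Pi Pj with j ≟ i
... | yes j≡i = sym j≡i
... | no j≢i  = contradiction (suc-injective (trans (sym (count-remove P? Pi)) count≡1))
                              (>⇒≢ (count-pos (remove? P? i) (Pj , j≢i)))

InjectiveOn : {A : Set ℓ′} → Pred (Fin k) ℓ → (Fin k → A) → Set (ℓ ⊔ ℓ′)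
InjectiveOn P f = ∀ {i j} → P i → P j → f i ≡ f j → i ≡ j

count-≤-injection : {P : Pred (Fin k) ℓ} {Q : Pred (Fin l) ℓ′} (P? : Decidable P) (Q? : Decidable Q)
                    (f : Fin k → Fin l) →
                    (∀ {i} → P i → Q (f i)) → InjectiveOn P f → count P? ≤ count Q?
count-≤-injection {k = zero}  P? Q? f P⇒Qf f-inj = z≤n
count-≤-injection {k = suc k} P? Q? f P⇒Qf f-inj with P? zero
... | no _   =
  count-≤-injection (P? ∘ suc) Q? (f ∘ suc) P⇒Qf λ Pi Pj eq → Finₚ.suc-injective (f-inj Pi Pj eq)
... | yes P0 = begin
  suc (count (P? ∘ suc))
    ≤⟨ s≤s (count-≤-injection (P? ∘ suc) (remove? Q? (f zero)) (f ∘ suc)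
              (λ Pi → P⇒Qf Pi , λ eq → 0≢suc (f-inj P0 Pi (sym eq)))
              (λ Pi Pj eq → Finₚ.suc-injective (f-inj Pi Pj eq))) ⟩
  suc (count (remove? Q? (f zero)))
    ≡⟨ count-remove Q? (P⇒Qf P0) ⟨
  count Q?
    ∎
  where
  open ≤-Reasoning
  0≢suc : ∀ {i : Fin k} → zero ≢ suc i
  0≢suc ()

count-≡ : {P : Pred (Fin k) ℓ} {Q : Pred (Fin l) ℓ′} (P? : Decidable P) (Q? : Decidable Q)
          (f : Fin k → Fin l) → (∀ {i} → P i → Q (f i)) → InjectiveOn P f →
          (g : Fin l → Fin k) → (∀ {i} → Q i → P (g i)) → InjectiveOn Q g →
          count P? ≡ count Q?
count-≡ P? Q? f P⇒Qf f-inj g Q⇒Pg g-inj =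
  ≤-antisym (count-≤-injection P? Q? f P⇒Qf f-inj) (count-≤-injection Q? P? g Q⇒Pg g-inj)

count-mono-< : {P : Pred (Fin k) ℓ} {Q : Pred (Fin k) ℓ′} (P? : Decidable P) (Q? : Decidable Q) →
               (∀ {i} → P i → Q i) → ∀ {i} → ¬ P i → Q i → count P? < count Q?
count-mono-< P? Q? P⊆Q {i} ¬Pi Qi = begin-strict
  count P?                    ≤⟨ count-≤-injection P? (remove? Q? i) id
                                   (λ Pj → P⊆Q Pj , λ { refl → ¬Pi Pj }) (λ _ _ eq → eq) ⟩
  count (remove? Q? i)        <⟨ n<1+n _ ⟩
  suc (count (remove? Q? i))  ≡⟨ count-remove Q? Qi ⟨
  count Q?                    ∎
  where open ≤-Reasoning

∣tabulate∣≡count : {P : Pred (Fin k) ℓ} (P? : Decidable P) →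
                   ∣ tabulate (does ∘ P?) ∣ ≡ count P?
∣tabulate∣≡count {k = zero}  P? = refl
∣tabulate∣≡count {k = suc k} P? with P? zero
... | yes _ = cong suc (∣tabulate∣≡count (P? ∘ suc))
... | no _  = ∣tabulate∣≡count (P? ∘ suc)

module Rank {k ℓ} {P : Pred (Fin k) ℓ} (P? : Decidable P) (key : Fin k → ℕ) where

  Below : Fin k → Pred (Fin k) ℓ
  Below i j = P j × key j < key i

  below? : ∀ i → Decidable (Below i)
  below? i j = P? j ×-dec key j <? key i

  rank : Fin k → ℕ
  rank i = count (below? i)

  rank<count : ∀ {i} → P i → rank i < count P?
  rank<count Pi = count-mono-< (below? _) P? proj₁ (λ (_ , i<i) → <-irrefl refl i<i) Pi

  rank-strictMono : ∀ {i j} → P i → key i < key j → rank i < rank j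
  rank-strictMono {i} {j} Pi i<j =
    count-mono-< (below? i) (below? j) (λ (Pl , l<i) → Pl , <-trans l<i i<j)
                 (λ (_ , i<i) → <-irrefl refl i<i) (Pi , i<j)

  rank-injective : InjectiveOn P key → InjectiveOn P rank
  rank-injective key-injective {i} {j} Pi Pj rank≡ with <-cmp (key i) (key j)
  ... | tri< i<j _ _ = contradiction rank≡ (<⇒≢ (rank-strictMono Pi i<j))
  ... | tri≈ _ i≡j _ = key-injective Pi Pj i≡j
  ... | tri> _ _ j<i = contradiction (sym rank≡) (<⇒≢ (rank-strictMono Pj j<i))

  rank-key≡0 : ∀ {i} → key i ≡ 0 → rank i ≡ 0
  rank-key≡0 {i} key≡0 = count-none (below? i) λ j (_ , j<i) → n≮0 (subst (key j <_) key≡0 j<i)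

-- Subset sums of three numbers

private
  no-gain : ∀ {x s t} → 0 < x → t ≤ s → x + s ≢ t
  no-gain {x} {s} 0<x t≤s eq = <-irrefl refl (<-≤-trans (m<n+m s 0<x) (≤-trans (≤-reflexive eq) t≤s))

·-injective : ∀ {x} → 0 < x → ∀ a a′ → a · x ≡ a′ · x → a ≡ a′
·-injective 0<x true  true  _  = refl
·-injective 0<x false false _  = refl
·-injective 0<x true  false eq = contradiction eq (>⇒≢ 0<x)
·-injective 0<x false true  eq = contradiction eq (<⇒≢ 0<x)

module _ {y z : ℕ} (0<y : 0 < y) (0<z : 0 < z) (y≢z : y ≢ z) where

  private
    mismatch : ∀ c c′ → y + c · z ≢ c′ · z
    mismatch true  c′    = no-gain 0<y (·-≤ c′)
    mismatch false false = no-gain 0<y z≤n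
    mismatch false true  = λ eq → y≢z (trans (sym (+-identityʳ y)) eq)

  ·-injective₂ : ∀ b c b′ c′ → b · y + c · z ≡ b′ · y + c′ · z → b ≡ b′ × c ≡ c′
  ·-injective₂ true  c true  c′ eq = refl , ·-injective 0<z c c′ (+-cancelˡ-≡ y _ _ eq)
  ·-injective₂ false c false c′ eq = refl , ·-injective 0<z c c′ eq
  ·-injective₂ true  c false c′ eq = contradiction eq (mismatch c c′)
  ·-injective₂ false c true  c′ eq = contradiction (sym eq) (mismatch c′ c)

record SumFreeTriple (x y z : ℕ) : Set where
  field
    0<x   : 0 < x
    0<y   : 0 < y
    0<z   : 0 < z
    x≢y   : x ≢ y
    x≢z   : x ≢ z
    y≢z   : y ≢ z
    x≢y+z : x ≢ y + z
    y≢x+z : y ≢ x + z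
    z≢x+y : z ≢ x + y

module _ {x y z : ℕ} (sumFree : SumFreeTriple x y z) where
  open SumFreeTriple sumFree

  private
    -- If the right-hand side picks no more of y, z than the left, the left is larger;
    -- otherwise the equation is one of the excluded relations.
    mismatch : ∀ b c b′ c′ → x + (b · y + c · z) ≢ b′ · y + c′ · z
    mismatch true  true  b′    c′    = no-gain 0<x (+-mono-≤ (·-≤ b′) (·-≤ c′))
    mismatch true  false true  false = no-gain 0<x ≤-refl
    mismatch true  false false false = no-gain 0<x z≤n
    mismatch true  false false true  = λ eq → z≢x+y (sym (trans (cong (x +_) (sym (+-identityʳ y))) eq))
    mismatch true  false true  true  = λ eq → x≢z (+-cancelʳ-≡ y x z
                                         (trans (cong (x +_) (sym (+-identityʳ y))) (trans eq (+-comm y z))))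
    mismatch false true  false true  = no-gain 0<x ≤-refl
    mismatch false true  false false = no-gain 0<x z≤n
    mismatch false true  true  false = λ eq → y≢x+z (sym (trans eq (+-identityʳ y)))
    mismatch false true  true  true  = λ eq → x≢y (+-cancelʳ-≡ z x y eq)
    mismatch false false false false = no-gain 0<x z≤n
    mismatch false false true  false = λ eq → x≢y (trans (sym (+-identityʳ x))
                                                       (trans eq (+-identityʳ y)))
    mismatch false false false true  = λ eq → x≢z (trans (sym (+-identityʳ x)) eq)
    mismatch false false true  true  = λ eq → x≢y+z (trans (sym (+-identityʳ x)) eq)

  ·-injective₃ : ∀ a b c a′ b′ c′ →
                 a · x + (b · y + c · z) ≡ a′ · x + (b′ · y + c′ · z) → a ≡ a′ × b ≡ b′ × c ≡ c′
  ·-injective₃ true  b c true  b′ c′ eq =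
    refl , ·-injective₂ 0<y 0<z y≢z b c b′ c′ (+-cancelˡ-≡ x _ _ eq)
  ·-injective₃ false b c false b′ c′ eq = refl , ·-injective₂ 0<y 0<z y≢z b c b′ c′ eq
  ·-injective₃ true  b c false b′ c′ eq = contradiction eq (mismatch b c b′ c′)
  ·-injective₃ false b c true  b′ c′ eq = contradiction (sym eq) (mismatch b′ c′ b c)

private
  one-sided-gap : ∀ {K x y z d} → K ≤ x → z ≤ K + K → 0 < d → d ≢ z → y ≡ x + d →
                  x ≢ y + z × y ≢ x + z × z ≢ x + y
  one-sided-gap {K} {x} {y} {z} {d} K≤x z≤2K 0<d d≢z y≡x+d =
      (λ eq → <-irrefl eq (<-≤-trans x<y (m≤m+n y z)))
    , (λ eq → d≢z (+-cancelˡ-≡ x d z (trans (sym y≡x+d) eq)))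
    , (λ eq → <-irrefl eq (≤-<-trans z≤2K (+-mono-≤-< K≤x (≤-<-trans K≤x x<y))))
    where
    x<y : x < y
    x<y = subst (x <_) (sym y≡x+d) (m<m+n x 0<d)

gap-excludes-sums : ∀ {K x y z d} → K ≤ x → K ≤ y → z ≤ K + K → 0 < d → d ≢ z →
                    y ≡ x + d ⊎ x ≡ y + d → x ≢ y + z × y ≢ x + z × z ≢ x + y
gap-excludes-sums K≤x K≤y z≤2K 0<d d≢z (inj₁ y≡x+d) = one-sided-gap K≤x z≤2K 0<d d≢z y≡x+d
gap-excludes-sums {x = x} {y} K≤x K≤y z≤2K 0<d d≢z (inj₂ x≡y+d)
  with one-sided-gap K≤y z≤2K 0<d d≢z x≡y+d
... | y≢x+z , x≢y+z , z≢y+x = x≢y+z , y≢x+z , λ eq → z≢y+x (trans eq (+-comm x y))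

-- The cyclic order on Fin n

data CyclicSucc {n} (i j : Fin n) : Set where
  step : toℕ j ≡ suc (toℕ i) → CyclicSucc i j
  wrap : toℕ i ≡ n ∸ 1 → toℕ j ≡ 0 → CyclicSucc i j

next : ∀ {n} → Fin n → Fin n
next {suc n} i with n ℕₚ.≟ toℕ i
... | yes _   = zero
... | no n≢i = suc (lower₁ i n≢i)

prev : ∀ {n} → Fin n → Fin n
prev {suc n} zero    = fromℕ n
prev {suc n} (suc i) = inject₁ i

CyclicSucc-next : ∀ {n} (i : Fin n) → CyclicSucc i (next i)
CyclicSucc-next {suc n} i with n ℕₚ.≟ toℕ i
... | yes n≡i = wrap (sym n≡i) refl
... | no n≢i  = step (cong suc (toℕ-lower₁ i n≢i))

CyclicSucc-prev : ∀ {n} (i : Fin n) → CyclicSucc (prev i) i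
CyclicSucc-prev {suc n} zero    = wrap (toℕ-fromℕ n) refl
CyclicSucc-prev {suc n} (suc i) = step (cong suc (sym (toℕ-inject₁ i)))

toℕ≡n∸1⇒suc≡n : ∀ {n} {i : Fin n} → toℕ i ≡ n ∸ 1 → suc (toℕ i) ≡ n
toℕ≡n∸1⇒suc≡n {suc n} i≡n-1 = cong suc i≡n-1

module _ {n : ℕ} where

  CyclicSucc-functional : ∀ {i j j′ : Fin n} → CyclicSucc i j → CyclicSucc i j′ → j ≡ j′
  CyclicSucc-functional (step j≡) (step j′≡) = toℕ-injective (trans j≡ (sym j′≡))
  CyclicSucc-functional {j = j} (step j≡) (wrap i≡ _) =
    contradiction (trans j≡ (toℕ≡n∸1⇒suc≡n i≡)) (<⇒≢ (toℕ<n j))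
  CyclicSucc-functional {j′ = j′} (wrap i≡ _) (step j′≡) =
    contradiction (trans j′≡ (toℕ≡n∸1⇒suc≡n i≡)) (<⇒≢ (toℕ<n j′))
  CyclicSucc-functional (wrap _ j≡0) (wrap _ j′≡0) = toℕ-injective (trans j≡0 (sym j′≡0))

  CyclicSucc-injective : ∀ {i i′ j : Fin n} → CyclicSucc i j → CyclicSucc i′ j → i ≡ i′
  CyclicSucc-injective (step j≡) (step j≡′) =
    toℕ-injective (ℕₚ.suc-injective (trans (sym j≡) j≡′))
  CyclicSucc-injective (step j≡) (wrap _ j≡0) = contradiction (trans (sym j≡) j≡0) λ ()
  CyclicSucc-injective (wrap _ j≡0) (step j≡) = contradiction (trans (sym j≡) j≡0) λ ()
  CyclicSucc-injective (wrap i≡ _) (wrap i′≡ _) = toℕ-injective (trans i≡ (sym i′≡))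

  CyclicSucc-irreflexive : 2 ≤ n → ∀ {i : Fin n} → ¬ CyclicSucc i i
  CyclicSucc-irreflexive _ {i} (step i≡) = <-irrefl i≡ (n<1+n (toℕ i))
  CyclicSucc-irreflexive 2≤n (wrap i≡ i≡0) =
    <-irrefl (trans (cong suc (sym i≡0)) (toℕ≡n∸1⇒suc≡n i≡)) 2≤n

  CyclicSucc-asym : 3 ≤ n → ∀ {i j : Fin n} → CyclicSucc i j → ¬ CyclicSucc j i
  CyclicSucc-asym _ {i} (step j≡) (step i≡) =
    <-irrefl (trans i≡ (cong suc j≡)) (<-trans (n<1+n (toℕ i)) (n<1+n (suc (toℕ i))))
  CyclicSucc-asym 3≤n (step j≡) (wrap j≡last i≡0) =
    <-irrefl (trans (cong (2 +_) (sym i≡0)) (trans (cong suc (sym j≡)) (toℕ≡n∸1⇒suc≡n j≡last)))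
             3≤n
  CyclicSucc-asym 3≤n (wrap i≡last j≡0) (step i≡) =
    <-irrefl (trans (cong (2 +_) (sym j≡0)) (trans (cong suc (sym i≡)) (toℕ≡n∸1⇒suc≡n i≡last)))
             3≤n
  CyclicSucc-asym 3≤n (wrap _ j≡0) (wrap j≡last _) =
    <-irrefl (trans (cong suc (sym j≡0)) (toℕ≡n∸1⇒suc≡n j≡last))
             (≤-trans (s≤s (s≤s z≤n)) 3≤n)

-- The labels

data Parity : ℕ → Set where
  even : ∀ j → Parity (j + j)
  odd  : ∀ j → Parity (suc (j + j))

parity : ∀ a → Parity a
parity zero = even 0
parity (suc a) with parity a
... | even j = odd j
... | odd j  = subst Parity (cong suc (+-suc j j)) (even (suc j))

double-injective : ∀ {i j} → i + i ≡ j + j → i ≡ j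
double-injective {i} {j} eq = trans (n≡⌊n+n/2⌋ i) (trans (cong ⌊_/2⌋ eq) (sym (n≡⌊n+n/2⌋ j)))

half-< : ∀ {j K} → j + j < K + K → j < K
half-< j+j<K+K = ≰⇒> λ K≤j → <⇒≱ j+j<K+K (+-mono-≤ K≤j K≤j)

module Labels (K : ℕ) where

  cycleLabel : ℕ → ℕ
  cycleLabel 0             = K
  cycleLabel 1             = suc (K + K)
  cycleLabel (suc (suc a)) = suc (cycleLabel a)

  cycleLabel-even : ∀ j → cycleLabel (j + j) ≡ K + j
  cycleLabel-even zero    = sym (+-identityʳ K)
  cycleLabel-even (suc j) = begin
    cycleLabel (suc (j + suc j))  ≡⟨ cong (λ t → cycleLabel (1 + t)) (+-suc j j) ⟩
    suc (cycleLabel (j + j))      ≡⟨ cong suc (cycleLabel-even j) ⟩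
    suc (K + j)                   ≡⟨ +-suc K j ⟨
    K + suc j                     ∎
    where open ≡-Reasoning

  cycleLabel-odd : ∀ j → cycleLabel (suc (j + j)) ≡ suc (K + K + j)
  cycleLabel-odd zero    = cong suc (sym (+-identityʳ (K + K)))
  cycleLabel-odd (suc j) = begin
    cycleLabel (suc (suc (j + suc j)))  ≡⟨ cong (λ t → cycleLabel (2 + t)) (+-suc j j) ⟩
    suc (cycleLabel (suc (j + j)))      ≡⟨ cong suc (cycleLabel-odd j) ⟩
    suc (suc (K + K + j))               ≡⟨ cong suc (+-suc (K + K) j) ⟨
    suc (K + K + suc j)                 ∎
    where open ≡-Reasoning

  cycleLabel-step : ∀ a → cycleLabel (suc a) ≡ cycleLabel a + suc K
                          ⊎ cycleLabel a ≡ cycleLabel (suc a) + K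
  cycleLabel-step 0             = inj₁ (sym (+-suc K K))
  cycleLabel-step 1             = inj₂ refl
  cycleLabel-step (suc (suc a)) = Sum.map (cong suc) (cong suc) (cycleLabel-step a)

  cycleLabel-wrap : ∀ {a} → suc a ≡ K + K → cycleLabel a ≡ cycleLabel 0 + (K + K)
  cycleLabel-wrap {a} eq with parity a
  -- The standard library states parity with 2 * j = j + (j + 0).
  ... | even j = ⊥-elim (even≢odd K j (begin
    K + (K + 0)        ≡⟨ cong (K +_) (+-identityʳ K) ⟩
    K + K              ≡⟨ eq ⟨
    suc (j + j)        ≡⟨ cong (λ t → suc (j + t)) (+-identityʳ j) ⟨
    suc (j + (j + 0))  ∎))
    where open ≡-Reasoning
  ... | odd j  = begin
    cycleLabel (suc (j + j))  ≡⟨ cycleLabel-odd j ⟩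
    suc (K + K + j)           ≡⟨ +-suc (K + K) j ⟨
    K + K + suc j             ≡⟨ cong (K + K +_) sj≡K ⟩
    K + K + K                 ≡⟨ +-assoc K K K ⟩
    K + (K + K)               ∎
    where
    open ≡-Reasoning
    sj≡K : suc j ≡ K
    sj≡K = double-injective (trans (cong suc (+-suc j j)) eq)

  cycleLabel-≥ : ∀ a → K ≤ cycleLabel a
  cycleLabel-≥ 0             = ≤-refl
  cycleLabel-≥ 1             = m≤n⇒m≤1+n (m≤m+n K K)
  cycleLabel-≥ (suc (suc a)) = m≤n⇒m≤1+n (cycleLabel-≥ a)

  cycleLabel-≤ : ∀ {a} → a < K + K → cycleLabel a ≤ K + K + K
  cycleLabel-≤ {a} a<2K with parity a
  ... | even j = subst (_≤ K + K + K) (sym (cycleLabel-even j))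
                   (≤-trans (+-monoʳ-≤ K (<⇒≤ (half-< a<2K))) (m≤m+n (K + K) K))
  ... | odd j  = subst (_≤ K + K + K) (trans (+-suc (K + K) j) (sym (cycleLabel-odd j)))
                   (+-monoʳ-≤ (K + K) (half-< (<-trans (n<1+n _) a<2K)))

  cycleLabel-≢2K : ∀ {a} → a < K + K → cycleLabel a ≢ K + K
  cycleLabel-≢2K {a} a<2K with parity a
  ... | even j = λ eq → <-irrefl (trans (sym (cycleLabel-even j)) eq) (+-monoʳ-< K (half-< a<2K))
  ... | odd j  = λ eq → <-irrefl (trans (sym eq) (cycleLabel-odd j)) (s≤s (m≤m+n (K + K) j))

  cycleLabel-injective : ∀ {a b} → a < K + K → b < K + K → cycleLabel a ≡ cycleLabel b → a ≡ b
  cycleLabel-injective {a} {b} a<2K b<2K eq with parity a | parity b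
  ... | even i | even j = cong (λ t → t + t) (+-cancelˡ-≡ K i j
                            (trans (sym (cycleLabel-even i)) (trans eq (cycleLabel-even j))))
  ... | odd i  | odd j  = cong (λ t → suc (t + t)) (+-cancelˡ-≡ (K + K) i j (ℕₚ.suc-injective
                            (trans (sym (cycleLabel-odd i)) (trans eq (cycleLabel-odd j)))))
  ... | even i | odd j  = contradiction (trans (sym (cycleLabel-even i)) (trans eq (cycleLabel-odd j)))
                            (<⇒≢ (<-trans (+-monoʳ-< K (half-< a<2K)) (s≤s (m≤m+n (K + K) j))))
  ... | odd i  | even j = contradiction (trans (sym (cycleLabel-even j)) (trans (sym eq) (cycleLabel-odd i)))
                            (<⇒≢ (<-trans (+-monoʳ-< K (half-< b<2K)) (s≤s (m≤m+n (K + K) i))))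

  -- K is a cycle label, so the chord of rank K − 1 gets 2K instead.
  chordLabel : ℕ → ℕ
  chordLabel r with suc r ℕₚ.≟ K
  ... | yes _ = K + K
  ... | no _  = suc r

  chordLabel-range : ∀ {r} → r < K → (0 < chordLabel r × chordLabel r < K) ⊎ chordLabel r ≡ K + K
  chordLabel-range {r} r<K with suc r ℕₚ.≟ K
  ... | yes _   = inj₂ refl
  ... | no r+1≢K = inj₁ (z<s , ≤∧≢⇒< r<K r+1≢K)

  private
    below-2K : ∀ {t} → t < K → suc t < K + K
    below-2K t<K = ≤-<-trans t<K (m<m+n K (≤-trans (s≤s z≤n) t<K))

  chordLabel-injective : ∀ {r s} → r < K → s < K → chordLabel r ≡ chordLabel s → r ≡ s
  chordLabel-injective {r} {s} r<K s<K eq with suc r ℕₚ.≟ K | suc s ℕₚ.≟ K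
  ... | yes r+1≡K | yes s+1≡K = ℕₚ.suc-injective (trans r+1≡K (sym s+1≡K))
  ... | no _      | no _      = ℕₚ.suc-injective eq
  ... | yes _     | no _      = contradiction eq (≢-sym (<⇒≢ (below-2K s<K)))
  ... | no _      | yes _     = contradiction eq (<⇒≢ (below-2K r<K))

  chordLabel-0 : 2 ≤ K → chordLabel 0 ≡ 1
  chordLabel-0 2≤K with 1 ℕₚ.≟ K
  ... | yes 1≡K = contradiction 1≡K (<⇒≢ 2≤K)
  ... | no _    = refl

  chordLabel-≤ : ∀ {r} → r < K → chordLabel r ≤ K + K
  chordLabel-≤ r<K with chordLabel-range r<K
  ... | inj₁ (_ , c<K) = ≤-trans (<⇒≤ c<K) (m≤m+n K K)
  ... | inj₂ c≡2K      = ≤-reflexive c≡2K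

  chordLabel-≢ : ∀ {r d} → r < K → K ≤ d → d ≢ K + K → chordLabel r ≢ d
  chordLabel-≢ r<K K≤d d≢2K eq with chordLabel-range r<K
  ... | inj₁ (_ , c<K) = <⇒≱ c<K (subst (K ≤_) (sym eq) K≤d)
  ... | inj₂ c≡2K      = d≢2K (trans (sym eq) c≡2K)

-- Hamiltonian cubic graphs

module GraphProperties (G : Graph) where
  open Graph G

  Joins : Fin m → Fin n → Fin n → Set
  Joins e u w = ends e ≡ (u , w) ⊎ ends e ≡ (w , u)

  Joins-incidentˡ : ∀ {e u w} → Joins e u w → Incident G u e
  Joins-incidentˡ (inj₁ eq) = inj₁ (cong proj₁ eq)
  Joins-incidentˡ (inj₂ eq) = inj₂ (cong proj₂ eq)

  Joins-incidentʳ : ∀ {e u w} → Joins e u w → Incident G w e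
  Joins-incidentʳ (inj₁ eq) = inj₂ (cong proj₂ eq)
  Joins-incidentʳ (inj₂ eq) = inj₁ (cong proj₁ eq)

  Joins-incident⁻ : ∀ {e u w v} → Joins e u w → Incident G v e → v ≡ u ⊎ v ≡ w
  Joins-incident⁻ (inj₁ eq) (inj₁ v≡) = inj₁ (trans (sym v≡) (cong proj₁ eq))
  Joins-incident⁻ (inj₁ eq) (inj₂ v≡) = inj₂ (trans (sym v≡) (cong proj₂ eq))
  Joins-incident⁻ (inj₂ eq) (inj₁ v≡) = inj₂ (trans (sym v≡) (cong proj₁ eq))
  Joins-incident⁻ (inj₂ eq) (inj₂ v≡) = inj₁ (trans (sym v≡) (cong proj₂ eq))

  Joins-unique : ∀ {e u w u′ w′} → Joins e u w → Joins e u′ w′ →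
                 u ≡ u′ × w ≡ w′ ⊎ u ≡ w′ × w ≡ u′
  Joins-unique (inj₁ eq) (inj₁ eq′) = inj₁ (,-injective (trans (sym eq) eq′))
  Joins-unique (inj₂ eq) (inj₂ eq′) = inj₁ (swap (,-injective (trans (sym eq) eq′)))
  Joins-unique (inj₁ eq) (inj₂ eq′) = inj₂ (,-injective (trans (sym eq) eq′))
  Joins-unique (inj₂ eq) (inj₁ eq′) = inj₂ (swap (,-injective (trans (sym eq) eq′)))

  Incident? : ∀ v → Decidable (Incident G v)
  Incident? v e = (proj₁ (ends e) ≟ v) ⊎-dec (proj₂ (ends e) ≟ v)

  degree≡count : ∀ v → degree G v ≡ count (Incident? v)
  degree≡count v = ∣tabulate∣≡count (Incident? v)

  ⊆-incident : ∀ {v S e} → S ⊆ incidentEdges G v → lookup S e ≡ true → Incident G v e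
  ⊆-incident {v} {S} {e} S⊆ Se = does⇒ (Incident? v e) (begin
    does (Incident? v e)                ≡⟨ lookup∘tabulate (does ∘ Incident? v) e ⟨
    lookup (incidentEdges G v) e        ≡⟨ []=⇒lookup (S⊆ (lookup⇒[]= e S Se)) ⟩
    true                                ∎)
    where open ≡-Reasoning

module HamiltonianCycle (G : Graph) (ham : Hamiltonian G) where
  open Graph G
  open GraphProperties G

  3≤n : 3 ≤ n
  3≤n = proj₁ ham

  σ : Fin n → Fin n
  σ = proj₁ (proj₂ ham)

  σ-injective : ∀ {p q} → σ p ≡ σ q → p ≡ q
  σ-injective = proj₁ (proj₁ (proj₂ (proj₂ ham)))

  position : Fin n → Fin n
  position v = proj₁ (proj₂ (proj₁ (proj₂ (proj₂ ham))) v)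

  σ-position : ∀ v → σ (position v) ≡ v
  σ-position v = proj₂ (proj₂ (proj₁ (proj₂ (proj₂ ham))) v) refl

  σ-adjacent : ∀ {p q} → CyclicSucc p q → Adjacent G (σ p) (σ q)
  σ-adjacent (step q≡)     = proj₁ (proj₂ (proj₂ (proj₂ ham))) _ _ q≡
  σ-adjacent (wrap p≡ q≡0) = proj₂ (proj₂ (proj₂ (proj₂ ham))) _ _ p≡ q≡0

  cycleEdge : Fin n → Fin m
  cycleEdge p = proj₁ (σ-adjacent (CyclicSucc-next p))

  cycleEdge-joins : ∀ p → Joins (cycleEdge p) (σ p) (σ (next p))
  cycleEdge-joins p = proj₂ (σ-adjacent (CyclicSucc-next p))

  cycleEdge-injective : ∀ {p q} → cycleEdge p ≡ cycleEdge q → p ≡ q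
  cycleEdge-injective {p} {q} eq
    with Joins-unique (cycleEdge-joins p) (subst (λ e → Joins e _ _) (sym eq) (cycleEdge-joins q))
  ... | inj₁ (σp≡σq , _)         = σ-injective σp≡σq
  ... | inj₂ (σp≡σnq , σnp≡σq) =
    contradiction (subst (CyclicSucc q) (sym (σ-injective σp≡σnq)) (CyclicSucc-next q))
                  (CyclicSucc-asym 3≤n (subst (CyclicSucc p) (σ-injective σnp≡σq) (CyclicSucc-next p)))

  next-prev : ∀ (p : Fin n) → next (prev p) ≡ p
  next-prev p = CyclicSucc-functional (CyclicSucc-next (prev p)) (CyclicSucc-prev p)

  cycleEdge-incident : ∀ p → Incident G (σ p) (cycleEdge p)
  cycleEdge-incident p = Joins-incidentˡ (cycleEdge-joins p)

  cycleEdge-prev-incident : ∀ p → Incident G (σ p) (cycleEdge (prev p))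
  cycleEdge-prev-incident p = subst (λ q → Incident G (σ q) (cycleEdge (prev p))) (next-prev p)
                                    (Joins-incidentʳ (cycleEdge-joins (prev p)))

  cycleEdge-incident⁻ : ∀ {p q} → Incident G (σ p) (cycleEdge q) → q ≡ p ⊎ q ≡ prev p
  cycleEdge-incident⁻ {p} {q} inc with Joins-incident⁻ (cycleEdge-joins q) inc
  ... | inj₁ σp≡σq  = inj₁ (σ-injective (sym σp≡σq))
  ... | inj₂ σp≡σnq = inj₂ (CyclicSucc-injective
                            (subst (CyclicSucc q) (σ-injective (sym σp≡σnq)) (CyclicSucc-next q))
                            (CyclicSucc-prev p))

  cycleEdge-prev≢cycleEdge : ∀ p → cycleEdge (prev p) ≢ cycleEdge p
  cycleEdge-prev≢cycleEdge p eq =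
    CyclicSucc-irreflexive (≤-trans (n≤1+n 2) 3≤n)
      (subst (λ q → CyclicSucc q p) (cycleEdge-injective eq) (CyclicSucc-prev p))

  IsCycleEdge : Fin m → Set
  IsCycleEdge e = ∃ λ p → cycleEdge p ≡ e

  IsCycleEdge? : Decidable IsCycleEdge
  IsCycleEdge? e = any? (λ p → cycleEdge p ≟ e)

  -- Only meaningful on cycle edges; on the other edges any position will do.
  cyclePosition : Fin m → Fin n
  cyclePosition e with IsCycleEdge? e
  ... | yes (p , _) = p
  ... | no _        = position (proj₁ (ends e))

  cycleEdge-cyclePosition : ∀ {e} → IsCycleEdge e → cycleEdge (cyclePosition e) ≡ e
  cycleEdge-cyclePosition {e} isCycle with IsCycleEdge? e
  ... | yes (_ , eq) = eq
  ... | no ¬isCycle  = contradiction isCycle ¬isCycle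

  count-cycleEdges : count IsCycleEdge? ≡ n
  count-cycleEdges = trans
    (count-≡ IsCycleEdge? always?
      cyclePosition (λ _ → _)
      (λ isCycle isCycle′ eq → trans (sym (cycleEdge-cyclePosition isCycle))
                                      (trans (cong cycleEdge eq) (cycleEdge-cyclePosition isCycle′)))
      cycleEdge (λ {p} _ → p , refl) (λ _ _ → cycleEdge-injective))
    (count-all always? (λ _ → _))
    where
    always? : Decidable {A = Fin n} (λ _ → ⊤)
    always? _ = yes _

module Chords (G : Graph) (cubic : Cubic G) (ham : Hamiltonian G) where
  open Graph G
  open GraphProperties G
  open HamiltonianCycle G ham

  inEdge outEdge : Fin n → Fin m
  inEdge v  = cycleEdge (prev (position v))
  outEdge v = cycleEdge (position v)

  inEdge-incident : ∀ v → Incident G v (inEdge v)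
  inEdge-incident v =
    subst (λ w → Incident G w (inEdge v)) (σ-position v) (cycleEdge-prev-incident (position v))

  outEdge-incident : ∀ v → Incident G v (outEdge v)
  outEdge-incident v =
    subst (λ w → Incident G w (outEdge v)) (σ-position v) (cycleEdge-incident (position v))

  inEdge≢outEdge : ∀ v → inEdge v ≢ outEdge v
  inEdge≢outEdge v = cycleEdge-prev≢cycleEdge (position v)

  cycleEdge-at : ∀ {v e} → IsCycleEdge e → Incident G v e → e ≡ inEdge v ⊎ e ≡ outEdge v
  cycleEdge-at {v} (q , refl) inc
    with cycleEdge-incident⁻ (subst (λ w → Incident G w (cycleEdge q)) (sym (σ-position v)) inc)
  ... | inj₁ q≡p     = inj₂ (cong cycleEdge q≡p)
  ... | inj₂ q≡prevp = inj₁ (cong cycleEdge q≡prevp)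

  IsChordAt : Fin n → Fin m → Set
  IsChordAt v e = (Incident G v e × e ≢ inEdge v) × e ≢ outEdge v

  IsChordAt? : ∀ v → Decidable (IsChordAt v)
  IsChordAt? v = remove? (remove? (Incident? v) (inEdge v)) (outEdge v)

  count-IsChordAt : ∀ v → count (IsChordAt? v) ≡ 1
  count-IsChordAt v = sym (ℕₚ.suc-injective (ℕₚ.suc-injective (begin
    3                                 ≡⟨ cubic v ⟨
    degree G v                        ≡⟨ degree≡count v ⟩
    count (Incident? v)               ≡⟨ count-remove (Incident? v) (inEdge-incident v) ⟩
    suc (count (remove? (Incident? v) (inEdge v)))
      ≡⟨ cong suc (count-remove (remove? (Incident? v) (inEdge v))
                                (outEdge-incident v , ≢-sym (inEdge≢outEdge v))) ⟩
    suc (suc (count (IsChordAt? v)))  ∎)))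
    where open ≡-Reasoning

  chord : Fin n → Fin m
  chord v = proj₁ (count-witness (IsChordAt? v) (≤-reflexive (sym (count-IsChordAt v))))

  chord-IsChordAt : ∀ v → IsChordAt v (chord v)
  chord-IsChordAt v = proj₂ (count-witness (IsChordAt? v) (≤-reflexive (sym (count-IsChordAt v))))

  chord-unique : ∀ {v e} → IsChordAt v e → e ≡ chord v
  chord-unique {v} chordAt = count≡1-unique (IsChordAt? v) (count-IsChordAt v) chordAt (chord-IsChordAt v)

  chord-incident : ∀ v → Incident G v (chord v)
  chord-incident v = proj₁ (proj₁ (chord-IsChordAt v))

  chord≢inEdge : ∀ v → chord v ≢ inEdge v
  chord≢inEdge v = proj₂ (proj₁ (chord-IsChordAt v))

  chord≢outEdge : ∀ v → chord v ≢ outEdge v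
  chord≢outEdge v = proj₂ (chord-IsChordAt v)

  chord-not-cycleEdge : ∀ v → ¬ IsCycleEdge (chord v)
  chord-not-cycleEdge v isCycle with cycleEdge-at isCycle (chord-incident v)
  ... | inj₁ ≡in  = chord≢inEdge v ≡in
  ... | inj₂ ≡out = chord≢outEdge v ≡out

  IsChord : Fin m → Set
  IsChord e = ¬ IsCycleEdge e

  IsChord? : Decidable IsChord
  IsChord? = ¬? ∘ IsCycleEdge?

  chord-of-incident : ∀ {v e} → IsChord e → Incident G v e → e ≡ chord v
  chord-of-incident isChord inc =
    chord-unique ((inc , λ { refl → isChord (_ , refl) }) , λ { refl → isChord (_ , refl) })

  chordCount : ℕ
  chordCount = count IsChord?

  edgeCount : n + chordCount ≡ m
  edgeCount = trans (cong (_+ chordCount) (sym count-cycleEdges)) (count-complement IsCycleEdge?)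

  private
    Owns? : (end : Fin n × Fin n → Fin n) → Decidable (λ v → end (ends (chord v)) ≡ v)
    Owns? end v = end (ends (chord v)) ≟ v

    count-Owns : ∀ end → (∀ e → Incident G (end (ends e)) e) → count (Owns? end) ≡ chordCount
    count-Owns end end-incident = count-≡ (Owns? end) IsChord?
      chord (λ {v} _ → chord-not-cycleEdge v)
      (λ owns owns′ eq → trans (sym owns) (trans (cong (end ∘ ends) eq) owns′))
      (end ∘ ends) (λ {e} isChord → cong (end ∘ ends) (sym (chord-of-incident isChord (end-incident e))))
      (λ {e} {e′} isChord isChord′ eq → trans (chord-of-incident isChord (end-incident e))
        (trans (cong chord eq) (sym (chord-of-incident isChord′ (end-incident e′)))))

  -- Each vertex is exactly one of the two endpoints of its chord.
  vertexCount : n ≡ chordCount + chordCount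
  vertexCount = begin
    n                                               ≡⟨ count-complement (Owns? proj₁) ⟨
    count (Owns? proj₁) + count (¬? ∘ Owns? proj₁)
      ≡⟨ cong (count (Owns? proj₁) +_) (count-cong (¬? ∘ Owns? proj₁) (Owns? proj₂) other-end) ⟩
    count (Owns? proj₁) + count (Owns? proj₂)
      ≡⟨ cong₂ _+_ (count-Owns proj₁ (λ _ → inj₁ refl)) (count-Owns proj₂ (λ _ → inj₂ refl)) ⟩
    chordCount + chordCount                         ∎
    where
    open ≡-Reasoning
    other-end : ∀ v → (¬ proj₁ (ends (chord v)) ≡ v) ⇔ (proj₂ (ends (chord v)) ≡ v)
    other-end v = mk⇔ (λ ¬first → case chord-incident v of λ where
                                    (inj₁ first)  → contradiction first ¬first
                                    (inj₂ second) → second)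
                      (λ second first → loopless (chord v) (trans first (sym second)))

-- The AR-labelling

module ARLabelling (G : Graph) (cubic : Cubic G) (ham : Hamiltonian G) where
  open Graph G
  open GraphProperties G
  open HamiltonianCycle G ham
  open Chords G cubic ham

  K : ℕ
  K = chordCount

  2≤K : 2 ≤ K
  2≤K = ≰⇒> λ K≤1 → <⇒≱ 3≤n (subst (_≤ 2) (sym vertexCount) (+-mono-≤ K≤1 K≤1))

  3K≡m : K + K + K ≡ m
  3K≡m = trans (cong (_+ K) (sym vertexCount)) edgeCount

  open Labels K

  origin : Fin n
  origin = fromℕ< (≤-trans (s≤s z≤n) 3≤n)

  firstChord : Fin m
  firstChord = chord (σ origin)

  -- key and label case on a Dec value through a helper: a `with` on `e ≟ firstChord`
  -- would make Agda normalise the large term firstChord.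
  private
    key-by : ∀ {e} → Dec (e ≡ firstChord) → ℕ
    key-by (yes _)     = 0
    key-by {e} (no _)  = suc (toℕ e)

  key : Fin m → ℕ
  key e = key-by (e ≟ firstChord)

  key-injective : ∀ {e e′} → key e ≡ key e′ → e ≡ e′
  key-injective {e} {e′} = by-cases (e ≟ firstChord) (e′ ≟ firstChord)
    where
    by-cases : (e? : Dec (e ≡ firstChord)) (e′? : Dec (e′ ≡ firstChord)) →
               key-by e? ≡ key-by e′? → e ≡ e′
    by-cases (yes e≡) (yes e′≡) _  = trans e≡ (sym e′≡)
    by-cases (no _)   (no _)    eq = toℕ-injective (ℕₚ.suc-injective eq)
    by-cases (yes _)  (no _)    ()
    by-cases (no _)   (yes _)   ()

  key-firstChord : key firstChord ≡ 0
  key-firstChord = cong key-by (proj₂ (dec-yes (firstChord ≟ firstChord) refl))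

  open Rank IsChord? key

  private
    label-by : ∀ {e} → Dec (IsCycleEdge e) → ℕ
    label-by (yes (p , _)) = cycleLabel (toℕ p)
    label-by {e} (no _)    = chordLabel (rank e)

  label : Fin m → ℕ
  label e = label-by (IsCycleEdge? e)

  position<2K : ∀ p → toℕ p < K + K
  position<2K p = subst (toℕ p <_) vertexCount (toℕ<n p)

  rank<K : ∀ {e} → IsChord e → rank e < K
  rank<K = rank<count

  label-cycleEdge : ∀ p → label (cycleEdge p) ≡ cycleLabel (toℕ p)
  label-cycleEdge p with dec-yes (IsCycleEdge? (cycleEdge p)) (p , refl)
  ... | (q , q≡p) , is-yes =
    trans (cong label-by is-yes) (cong (cycleLabel ∘ toℕ) (cycleEdge-injective q≡p))

  label-chord : ∀ {e} → IsChord e → label e ≡ chordLabel (rank e)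
  label-chord {e} isChord = cong label-by (dec-no (IsCycleEdge? e) isChord)

  label-range : ∀ e → 1 ≤ label e × label e ≤ m
  label-range e = by-cases (IsCycleEdge? e)
    where
    1≤K : 1 ≤ K
    1≤K = ≤-trans (s≤s z≤n) 2≤K

    chordLabel-range′ : ∀ {r} → r < K → 1 ≤ chordLabel r × chordLabel r ≤ m
    chordLabel-range′ r<K with chordLabel-range r<K
    ... | inj₁ (0<c , c<K) = 0<c , ≤-trans (<⇒≤ c<K) (subst (K ≤_) 3K≡m (m≤n+m K (K + K)))
    ... | inj₂ c≡2K        = subst (λ l → 1 ≤ l × l ≤ m) (sym c≡2K)
                               (≤-trans 1≤K (m≤m+n K K) , subst (K + K ≤_) 3K≡m (m≤m+n (K + K) K))

    by-cases : Dec (IsCycleEdge e) → 1 ≤ label e × label e ≤ m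
    by-cases (yes (p , refl)) = subst (λ l → 1 ≤ l × l ≤ m) (sym (label-cycleEdge p))
      (≤-trans 1≤K (cycleLabel-≥ _) ,
       subst (cycleLabel (toℕ p) ≤_) 3K≡m (cycleLabel-≤ (position<2K p)))
    by-cases (no isChord) =
      subst (λ l → 1 ≤ l × l ≤ m) (sym (label-chord isChord)) (chordLabel-range′ (rank<K isChord))

  label-injective : ∀ {e e′} → label e ≡ label e′ → e ≡ e′
  label-injective {e} {e′} = by-cases (IsCycleEdge? e) (IsCycleEdge? e′)
    where
    cycle≢chord : ∀ {p e} → IsChord e → cycleLabel (toℕ p) ≢ chordLabel (rank e)
    cycle≢chord {p} isChord eq =
      chordLabel-≢ (rank<K isChord) (cycleLabel-≥ _) (cycleLabel-≢2K (position<2K p)) (sym eq)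

    by-cases : Dec (IsCycleEdge e) → Dec (IsCycleEdge e′) → label e ≡ label e′ → e ≡ e′
    by-cases (yes (p , refl)) (yes (q , refl)) eq = cong cycleEdge (toℕ-injective
      (cycleLabel-injective (position<2K p) (position<2K q)
        (trans (sym (label-cycleEdge p)) (trans eq (label-cycleEdge q)))))
    by-cases (no isChord) (no isChord′) eq = rank-injective (λ _ _ → key-injective) isChord isChord′
      (chordLabel-injective (rank<K isChord) (rank<K isChord′)
        (trans (sym (label-chord isChord)) (trans eq (label-chord isChord′))))
    by-cases (yes (p , refl)) (no isChord′) eq = ⊥-elim $
      cycle≢chord isChord′ (trans (sym (label-cycleEdge p)) (trans eq (label-chord isChord′)))
    by-cases (no isChord) (yes (q , refl)) eq = ⊥-elim $
      cycle≢chord isChord (trans (sym (label-cycleEdge q)) (trans (sym eq) (label-chord isChord)))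

  module _ (v : Fin n) where
    private
      p : Fin n
      p = position v

      x y z : ℕ
      x = label (inEdge v)
      y = label (outEdge v)
      z = label (chord v)

      rank-chord<K : rank (chord v) < K
      rank-chord<K = rank<K (chord-not-cycleEdge v)

      x≡ : x ≡ cycleLabel (toℕ (prev p))
      x≡ = label-cycleEdge (prev p)

      y≡ : y ≡ cycleLabel (toℕ p)
      y≡ = label-cycleEdge p

      z≡ : z ≡ chordLabel (rank (chord v))
      z≡ = label-chord (chord-not-cycleEdge v)

      Excluded : Set
      Excluded = x ≢ y + z × y ≢ x + z × z ≢ x + y

      gap-excludes : ∀ {d} → 0 < d → d ≢ z → y ≡ x + d ⊎ x ≡ y + d → Excluded
      gap-excludes = gap-excludes-sums (subst (K ≤_) (sym x≡) (cycleLabel-≥ _))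
                                       (subst (K ≤_) (sym y≡) (cycleLabel-≥ _))
                                       (subst (_≤ K + K) (sym z≡) (chordLabel-≤ rank-chord<K))

      short-gap≢z : ∀ {d} → K ≤ d → d ≢ K + K → d ≢ z
      short-gap≢z K≤d d≢2K eq = chordLabel-≢ rank-chord<K K≤d d≢2K (sym (trans eq z≡))

      excluded-step : toℕ p ≡ suc (toℕ (prev p)) → Excluded
      excluded-step p≡ = by-cases (cycleLabel-step (toℕ (prev p)))
        where
        open ≡-Reasoning
        by-cases : cycleLabel (suc (toℕ (prev p))) ≡ cycleLabel (toℕ (prev p)) + suc K
                   ⊎ cycleLabel (toℕ (prev p)) ≡ cycleLabel (suc (toℕ (prev p))) + K → Excluded
        by-cases (inj₁ up) = gap-excludes z<s
          (short-gap≢z (n≤1+n K) (λ eq → <-irrefl eq (+-monoˡ-< K 2≤K)))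
          (inj₁ (begin
            y                                    ≡⟨ y≡ ⟩
            cycleLabel (toℕ p)                   ≡⟨ cong cycleLabel p≡ ⟩
            cycleLabel (suc (toℕ (prev p)))      ≡⟨ up ⟩
            cycleLabel (toℕ (prev p)) + suc K    ≡⟨ cong (_+ suc K) x≡ ⟨
            x + suc K                            ∎))
        by-cases (inj₂ down) = gap-excludes (≤-trans (s≤s z≤n) 2≤K)
          (short-gap≢z ≤-refl (λ eq → <-irrefl eq (m<m+n K (≤-trans (s≤s z≤n) 2≤K))))
          (inj₂ (begin
            x                                    ≡⟨ x≡ ⟩
            cycleLabel (toℕ (prev p))            ≡⟨ down ⟩
            cycleLabel (suc (toℕ (prev p))) + K  ≡⟨ cong (λ a → cycleLabel a + K) p≡ ⟨
            cycleLabel (toℕ p) + K               ≡⟨ cong (_+ K) y≡ ⟨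
            y + K                                ∎))

      excluded-wrap : toℕ (prev p) ≡ n ∸ 1 → toℕ p ≡ 0 → Excluded
      excluded-wrap prev≡last p≡0 =
        gap-excludes (≤-trans (s≤s z≤n) (≤-trans 2≤K (m≤m+n K K))) 2K≢z (inj₂ (begin
          x                             ≡⟨ x≡ ⟩
          cycleLabel (toℕ (prev p))     ≡⟨ cycleLabel-wrap
                                             (trans (toℕ≡n∸1⇒suc≡n prev≡last) vertexCount) ⟩
          cycleLabel 0 + (K + K)        ≡⟨ cong (λ a → cycleLabel a + (K + K)) p≡0 ⟨
          cycleLabel (toℕ p) + (K + K)  ≡⟨ cong (_+ (K + K)) y≡ ⟨
          y + (K + K)                   ∎))
        where
        open ≡-Reasoning
        v≡origin : v ≡ σ origin
        v≡origin = trans (sym (σ-position v))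
                         (cong σ (toℕ-injective (trans p≡0 (sym (toℕ-fromℕ< _)))))
        z≡1 : z ≡ 1
        z≡1 = begin
          z                             ≡⟨ z≡ ⟩
          chordLabel (rank (chord v))   ≡⟨ cong (chordLabel ∘ rank ∘ chord) v≡origin ⟩
          chordLabel (rank firstChord)  ≡⟨ cong chordLabel (rank-key≡0 key-firstChord) ⟩
          chordLabel 0                  ≡⟨ chordLabel-0 2≤K ⟩
          1                             ∎
        2K≢z : K + K ≢ z
        2K≢z eq = <-irrefl (sym (trans eq z≡1)) (≤-trans 2≤K (m≤m+n K K))

      excluded : Excluded
      excluded = by-cases (CyclicSucc-prev p)
        where
        by-cases : CyclicSucc (prev p) p → Excluded
        by-cases (step p≡)             = excluded-step p≡
        by-cases (wrap prev≡last p≡0) = excluded-wrap prev≡last p≡0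

      sumFree : SumFreeTriple x y z
      sumFree = record
        { 0<x   = proj₁ (label-range (inEdge v))
        ; 0<y   = proj₁ (label-range (outEdge v))
        ; 0<z   = proj₁ (label-range (chord v))
        ; x≢y   = inEdge≢outEdge v ∘ label-injective
        ; x≢z   = λ eq → chord≢inEdge v (sym (label-injective eq))
        ; y≢z   = λ eq → chord≢outEdge v (sym (label-injective eq))
        ; x≢y+z = proj₁ excluded
        ; y≢x+z = proj₁ (proj₂ excluded)
        ; z≢x+y = proj₂ (proj₂ excluded)
        }

      outside-false : ∀ {S i} → S ⊆ incidentEdges G v →
                      i ≢ inEdge v → i ≢ outEdge v → i ≢ chord v → lookup S i ≡ false
      outside-false {S} {i} S⊆ ≢in ≢out ≢chord with lookup S i in Si
      ... | false = refl
      ... | true  = contradiction (chord-unique ((⊆-incident S⊆ Si , ≢in) , ≢out)) ≢chord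

      subsetSum-at : ∀ {S} → S ⊆ incidentEdges G v →
                     subsetSum label S ≡
                       lookup S (inEdge v) · x + (lookup S (outEdge v) · y + lookup S (chord v) · z)
      subsetSum-at {S} S⊆ = trans (subsetSum≡sum label S)
        (sum-supported-on-three (λ i → lookup S i · label i)
          (inEdge≢outEdge v) (≢-sym (chord≢inEdge v)) (≢-sym (chord≢outEdge v))
          λ i ≢in ≢out ≢chord → cong (_· label i) (outside-false S⊆ ≢in ≢out ≢chord))

    arVertex : ARVertex G label v
    arVertex S T S⊆ T⊆ sums≡ =
      trans (sym (tabulate∘lookup S)) (trans (tabulate-cong same) (tabulate∘lookup T))
      where
      bits = ·-injective₃ sumFree _ _ _ _ _ _
               (trans (sym (subsetSum-at S⊆)) (trans sums≡ (subsetSum-at T⊆)))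
      same : ∀ i → lookup S i ≡ lookup T i
      same i with i ≟ inEdge v | i ≟ outEdge v | i ≟ chord v
      ... | yes refl | _        | _         = proj₁ bits
      ... | no _     | yes refl | _         = proj₁ (proj₂ bits)
      ... | no _     | no _     | yes refl  = proj₂ (proj₂ bits)
      ... | no ≢in   | no ≢out  | no ≢chord =
        trans (outside-false S⊆ ≢in ≢out ≢chord) (sym (outside-false T⊆ ≢in ≢out ≢chord))

theorem1 : (G : Graph) → Cubic G → Hamiltonian G → ARGraph G
theorem1 G cubic ham = label , label-range , label-injective , arVertex
  where open ARLabelling G cubic ham
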